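{- Let $R$ be a finite commutative ring, $V$ a finite $R$-module, $P$ a probability distribution on $V$ and $Q$ a probability distribution on $R$. \begin{enumerate} \item In the coin-toss walk with heads probability $0<\alpha<1$, if the support of $P$ generates the additive group of $V$, then the walk is irreducible. If, in addition, the submonoid of the multiplicative monoid of $R$ generated by the support of $Q$ contains $0$, then the coin-toss walk is aperiodic. \item If the support of $P$ generates the additive group of $V$ and the support of $Q$ contains $1$, then the affine walk is irreducible. If, moreover, the submonoid of the multiplicative monoid of $R$ generated by the support of $Q$ contains $0$, then the affine walk is aperiodic. \end{enumerate}
   Context: Rings are commutative with identity. Both walks are Markov chains with state space $V$. Coin-toss walk with heads probability $\alpha\in[0,1]$: from state $x\in V$, with probability $\alpha$ (heads) move to $x+b$ where $b\in V$ is chosen with probability $P(b)$, and with probability $1-\alpha$ (tails) move to $ax$ where $a\in R$ is chosen with probability $Q(a)$. Affine walk: from state $x$, choose independently $a\in R$ with probability $Q(a)$ and $b\in V$ with probability $P(b)$, and move to $ax+b$.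
   Formalization: The probability distributions P and Q take rational values, and the heads probability α ranges over the rationals. -}

module Defs where

open import Level using (0ℓ)
open import Data.Nat using (ℕ; zero; suc; _≥_)
open import Data.Nat.Divisibility using (_∣_)
open import Data.Fin using (Fin)
import Data.Fin as Fin
open import Data.Rational using (ℚ; 0ℚ; 1ℚ; _+_; _*_; _-_; _<_; _≤_)
open import Data.Product using (Σ; ∃)
open import Relation.Nullary using (yes; no)
open import Relation.Binary using (Setoid)
open import Relation.Binary.PropositionalEquality as ≡ using (_≡_)
open import Function.Bundles using (Inverse)
open import Algebra.Bundles using (CommutativeRing)
open import Algebra.Module.Bundles using (Module)

Finite : Setoid 0ℓ 0ℓ → Set
Finite S = Σ ℕ λ n → Inverse S (≡.setoid (Fin n))

module _ {S : Setoid 0ℓ 0ℓ} (fin : Finite S) where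
  open Setoid S renaming (Carrier to A)

  size : ℕ
  size = Σ.proj₁ fin

  index : A → Fin size
  index = Inverse.to (Σ.proj₂ fin)

  elem : Fin size → A
  elem = Inverse.from (Σ.proj₂ fin)

sumFin : ∀ {n} → (Fin n → ℚ) → ℚ
sumFin {zero}  f = 0ℚ
sumFin {suc n} f = f Fin.zero + sumFin (λ i → f (Fin.suc i))

-- Probability distributions on a finite setoid (values in ℚ), given on
-- the equivalence classes (indexed by Fin size).

record Dist {S : Setoid 0ℓ 0ℓ} (fin : Finite S) : Set where
  field
    prob    : Fin (size fin) → ℚ
    nonneg  : ∀ i → 0ℚ ≤ prob i
    total   : sumFin prob ≡ 1ℚ

Pr : {S : Setoid 0ℓ 0ℓ} {fin : Finite S} → Dist fin → Setoid.Carrier S → ℚ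
Pr {fin = fin} D x = Dist.prob D (index fin x)

[_≟_]in_ : {S : Setoid 0ℓ 0ℓ} → Setoid.Carrier S → Setoid.Carrier S → Finite S → ℚ
[ x ≟ y ]in fin with index fin x Fin.≟ index fin y
... | yes _ = 1ℚ
... | no  _ = 0ℚ

-- n-step accessibility: there is a path of length n with positive
-- one-step transition probabilities (equivalently K^n(x,y) > 0).
data Reach {A : Set} (K : A → A → ℚ) : ℕ → A → A → Set where
  here : ∀ {x} → Reach K 0 x x
  step : ∀ {n x y z} → 0ℚ < K x y → Reach K n y z → Reach K (suc n) x z

Irreducible : {A : Set} → (A → A → ℚ) → Set
Irreducible K = ∀ x y → ∃ λ n → Reach K n x y

Aperiodic : {A : Set} → (A → A → ℚ) → Set
Aperiodic K = ∀ x (d : ℕ) → (∀ n → n ≥ 1 → Reach K n x x → d ∣ n) → d ≡ 1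

module Walks (R : CommutativeRing 0ℓ 0ℓ) (V : Module R 0ℓ 0ℓ)
             (finR : Finite (CommutativeRing.setoid R))
             (finV : Finite (Module.≈ᴹ-setoid V)) where
  open CommutativeRing R using (0#; 1#) renaming (Carrier to Rc; _≈_ to _≈R_; _*_ to _·_)
  open Module V

  data AddGen (S : Carrierᴹ → Set) : Carrierᴹ → Set where
    gen  : ∀ {v} → S v → AddGen S v
    zer  : AddGen S 0ᴹ
    add  : ∀ {u v} → AddGen S u → AddGen S v → AddGen S (u +ᴹ v)
    neg  : ∀ {u} → AddGen S u → AddGen S (-ᴹ u)
    resp : ∀ {u v} → u ≈ᴹ v → AddGen S u → AddGen S v

  GeneratesV : (Carrierᴹ → Set) → Set
  GeneratesV S = ∀ v → AddGen S v

  data MulGen (S : Rc → Set) : Rc → Set where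
    gen  : ∀ {a} → S a → MulGen S a
    one  : MulGen S 1#
    mul  : ∀ {a b} → MulGen S a → MulGen S b → MulGen S (a · b)
    resp : ∀ {a b} → a ≈R b → MulGen S a → MulGen S b

  SuppV : Dist finV → Carrierᴹ → Set
  SuppV P v = 0ℚ < Pr P v

  SuppR : Dist finR → Rc → Set
  SuppR Q a = 0ℚ < Pr Q a

  coinToss : ℚ → Dist finV → Dist finR → Carrierᴹ → Carrierᴹ → ℚ
  coinToss α P Q x y =
    α * sumFin (λ i → Dist.prob P i * [ x +ᴹ elem finV i ≟ y ]in finV)
    + (1ℚ - α) * sumFin (λ j → Dist.prob Q j * [ elem finR j *ₗ x ≟ y ]in finV)

  affine : Dist finV → Dist finR → Carrierᴹ → Carrierᴹ → ℚ
  affine P Q x y =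
    sumFin (λ j → sumFin (λ i →
      Dist.prob Q j * Dist.prob P i * [ elem finR j *ₗ x +ᴹ elem finV i ≟ y ]in finV))

{-# OPTIONS --safe #-}
-- Every b in the support of P gives a positive-probability step x → x + b (for the affine walk
-- via a = 1), so every translation by an element of the submonoid generated by supp P is realised
-- by a path; in a finite group −u is a multiple of u, so this submonoid is the whole additive group
-- and the walk is irreducible. Composing the steps x ↦ ax (+ b) likewise realises, for each c in
-- the submonoid generated by supp Q, a map x ↦ cx + w by paths of one common length n. For c = 0
-- every state reaches w in exactly n steps; taking one or two steps from x, then n steps to w and
-- m steps back to x, gives the return times 1 + n + m and 2 + n + m, so the period is 1.
module Submission where

open import Defs
open import Level using (0ℓ)
open import Data.Product using (∃; _×_; _,_; proj₂)
open import Data.Nat as ℕ using (ℕ; zero; suc; s≤s; z≤n)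
import Data.Nat.Properties as ℕP
open import Data.Nat.Divisibility using (_∣_; ∣1⇒≡1; ∣m+n∣m⇒∣n)
open import Data.Fin as Fin using (Fin; toℕ)
import Data.Fin.Properties as FinP
open import Data.Rational using (ℚ; _<_; _≤_; _+_; _*_; _-_; 0ℚ; 1ℚ)
import Data.Rational as ℚ
import Data.Rational.Properties as ℚP
open import Relation.Nullary using (yes; no)
open import Relation.Binary using (Setoid)
open import Relation.Binary.PropositionalEquality as ≡ using (_≡_; cong; cong₂; subst)
open import Function.Bundles using (Inverse)
open import Data.Empty using (⊥-elim)
open import Algebra.Bundles using (CommutativeRing; Group)
open import Algebra.Module.Bundles using (Module)

*-pos : ∀ {p q} → 0ℚ < p → 0ℚ < q → 0ℚ < p * q
*-pos {p} {q} 0<p 0<q =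
  ℚP.positive⁻¹ (p * q) {{ℚP.pos*pos⇒pos p {{ℚ.positive 0<p}} q {{ℚ.positive 0<q}}}}

*-nonNeg : ∀ {p q} → 0ℚ ≤ p → 0ℚ ≤ q → 0ℚ ≤ p * q
*-nonNeg {p} {q} 0≤p 0≤q =
  ℚP.nonNegative⁻¹ (p * q) {{ℚP.nonNeg*nonNeg⇒nonNeg p {{ℚ.nonNegative 0≤p}} q {{ℚ.nonNegative 0≤q}}}}

sumFin-cong : ∀ {n} {f g : Fin n → ℚ} → (∀ i → f i ≡ g i) → sumFin f ≡ sumFin g
sumFin-cong {zero}  f≡g = ≡.refl
sumFin-cong {suc n} f≡g = cong₂ _+_ (f≡g Fin.zero) (sumFin-cong (λ i → f≡g (Fin.suc i)))

sumFin-nonNeg : ∀ {n} (f : Fin n → ℚ) → (∀ i → 0ℚ ≤ f i) → 0ℚ ≤ sumFin f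
sumFin-nonNeg {zero}  f f≥0 = ℚP.≤-refl
sumFin-nonNeg {suc n} f f≥0 =
  ℚP.+-mono-≤ (f≥0 Fin.zero) (sumFin-nonNeg (λ i → f (Fin.suc i)) (λ i → f≥0 (Fin.suc i)))

sumFin-pos : ∀ {n} (f : Fin n → ℚ) → (∀ i → 0ℚ ≤ f i) → ∀ i → 0ℚ < f i → 0ℚ < sumFin f
sumFin-pos {suc n} f f≥0 Fin.zero    fi>0 =
  ℚP.+-mono-<-≤ fi>0 (sumFin-nonNeg (λ i → f (Fin.suc i)) (λ i → f≥0 (Fin.suc i)))
sumFin-pos {suc n} f f≥0 (Fin.suc i) fi>0 =
  ℚP.+-mono-≤-< (f≥0 Fin.zero) (sumFin-pos (λ i → f (Fin.suc i)) (λ i → f≥0 (Fin.suc i)) i fi>0)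

sumFin-pos⇒∃-pos : ∀ {n} (f : Fin n → ℚ) → (∀ i → 0ℚ ≤ f i) → 0ℚ < sumFin f →
                   ∃ λ i → 0ℚ < f i
sumFin-pos⇒∃-pos {zero}  f f≥0 0<0 = ⊥-elim (ℚP.<-irrefl ≡.refl 0<0)
sumFin-pos⇒∃-pos {suc n} f f≥0 sum>0 with 0ℚ ℚP.<? f Fin.zero
... | yes f₀>0 = Fin.zero , f₀>0
... | no  f₀≯0 =
  let i , fi>0 = sumFin-pos⇒∃-pos (λ i → f (Fin.suc i)) (λ i → f≥0 (Fin.suc i)) tail>0
  in Fin.suc i , fi>0
  where
  f₀≡0 : f Fin.zero ≡ 0ℚ
  f₀≡0 = ℚP.≤-antisym (ℚP.≮⇒≥ f₀≯0) (f≥0 Fin.zero)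
  tail>0 : 0ℚ < sumFin (λ i → f (Fin.suc i))
  tail>0 = subst (0ℚ <_) (≡.trans (cong (_+ sumFin (λ i → f (Fin.suc i))) f₀≡0) (ℚP.+-identityˡ _)) sum>0

module _ {S : Setoid 0ℓ 0ℓ} (fin : Finite S) where
  open Setoid S renaming (Carrier to A)

  index-cong : ∀ {a b : A} → a ≈ b → index fin a ≡ index fin b
  index-cong = Inverse.to-cong (proj₂ fin)

  elem-index : ∀ (a : A) → elem fin (index fin a) ≈ a
  elem-index a = Inverse.inverseʳ (proj₂ fin) ≡.refl

  index-injective : ∀ {a b : A} → index fin a ≡ index fin b → a ≈ b
  index-injective {a} {b} eq =
    trans (sym (elem-index a)) (trans (Inverse.from-cong (proj₂ fin) eq) (elem-index b))

  indicator-nonNeg : ∀ (u v : A) → 0ℚ ≤ [ u ≟ v ]in fin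
  indicator-nonNeg u v with index fin u Fin.≟ index fin v
  ... | yes _ = ℚP.nonNegative⁻¹ 1ℚ
  ... | no  _ = ℚP.≤-refl

  indicator-≈ : ∀ {u v : A} → u ≈ v → [ u ≟ v ]in fin ≡ 1ℚ
  indicator-≈ {u} {v} u≈v with index fin u Fin.≟ index fin v
  ... | yes _ = ≡.refl
  ... | no  u≉v = ⊥-elim (u≉v (index-cong u≈v))

  indicator-cong : ∀ {u u′ v v′ : A} → u ≈ u′ → v ≈ v′ → [ u ≟ v ]in fin ≡ [ u′ ≟ v′ ]in fin
  indicator-cong {u} {u′} {v} {v′} u≈u′ v≈v′
    with index fin u Fin.≟ index fin v | index fin u′ Fin.≟ index fin v′
  ... | yes _   | yes _   = ≡.refl
  ... | no  _   | no  _   = ≡.refl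
  ... | yes u≡v | no  u≢v = ⊥-elim (u≢v (index-cong (trans (sym u≈u′) (trans (index-injective u≡v) v≈v′))))
  ... | no  u≢v | yes u≡v = ⊥-elim (u≢v (index-cong (trans u≈u′ (trans (index-injective u≡v) (sym v≈v′)))))

  support-nonempty : (D : Dist fin) → ∃ λ (a : A) → 0ℚ < Pr D a
  support-nonempty D =
    let i , pᵢ>0 = sumFin-pos⇒∃-pos (Dist.prob D) (Dist.nonneg D)
                     (subst (0ℚ <_) (≡.sym (Dist.total D)) (ℚP.positive⁻¹ 1ℚ))
    in elem fin i , subst (λ j → 0ℚ < Dist.prob D j) (≡.sym (Inverse.inverseˡ (proj₂ fin) refl)) pᵢ>0

module _ {S T : Setoid 0ℓ 0ℓ} (finS : Finite S) (finT : Finite T) where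
  private
    module S = Setoid S
    module T = Setoid T

  pushforward : Dist finS → (S.Carrier → T.Carrier) → T.Carrier → ℚ
  pushforward D f y = sumFin (λ i → Dist.prob D i * [ f (elem finS i) ≟ y ]in finT)

  pushforward-cong : ∀ (D : Dist finS) {f g y y′} → (∀ a → f a T.≈ g a) → y T.≈ y′ →
                     pushforward D f y ≡ pushforward D g y′
  pushforward-cong D f≈g y≈y′ = sumFin-cong λ i →
    cong (Dist.prob D i *_) (indicator-cong finT (f≈g (elem finS i)) y≈y′)

  pushforward-nonNeg : ∀ (D : Dist finS) f y → 0ℚ ≤ pushforward D f y
  pushforward-nonNeg D f y = sumFin-nonNeg _ λ i →
    *-nonNeg (Dist.nonneg D i) (indicator-nonNeg finT _ _)

  pushforward-pos : ∀ (D : Dist finS) {f a y} → (∀ {a b} → a S.≈ b → f a T.≈ f b) →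
                    0ℚ < Pr D a → f a T.≈ y → 0ℚ < pushforward D f y
  pushforward-pos D {f} {a} {y} f-cong Da>0 fa≈y =
    sumFin-pos _ (λ i → *-nonNeg (Dist.nonneg D i) (indicator-nonNeg finT _ _)) (index finS a)
      (subst (0ℚ <_) (≡.sym (≡.trans (cong (Pr D a *_) indicator≡1) (ℚP.*-identityʳ _))) Da>0)
    where
    indicator≡1 : [ f (elem finS (index finS a)) ≟ y ]in finT ≡ 1ℚ
    indicator≡1 = indicator-≈ finT (T.trans (f-cong (elem-index finS a)) fa≈y)

module _ (G : Group 0ℓ 0ℓ) (finG : Finite (Group.setoid G)) where
  open Group G
  open import Algebra.Properties.Group G using (∙-cancelˡ; inverseʳ-unique)
  open import Algebra.Properties.Monoid.Mult monoid using (×-homo-+) renaming (_×_ to _×ᴳ_)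
  open import Relation.Binary.Reasoning.Setoid setoid

  -- The multiples 0u, 1u, …, |G|u cannot all be distinct; iu ≈ (i + 1 + o)u gives u ∙ ou ≈ ε.
  inverse-is-multiple : ∀ u → ∃ λ k → k ×ᴳ u ≈ u ⁻¹
  inverse-is-multiple u
    with i , j , i<j , same-index ← FinP.pigeonhole (ℕP.n<1+n (size finG)) (λ k → index finG (toℕ k ×ᴳ u))
    with o , 1+i+o≡j ← ℕP.m≤n⇒∃[o]m+o≡n i<j
    = o , inverseʳ-unique u (o ×ᴳ u) (sym (∙-cancelˡ (toℕ i ×ᴳ u) ε (suc o ×ᴳ u) (begin
        toℕ i ×ᴳ u ∙ ε              ≈⟨ identityʳ (toℕ i ×ᴳ u) ⟩
        toℕ i ×ᴳ u                  ≈⟨ index-injective finG same-index ⟩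
        toℕ j ×ᴳ u                  ≡⟨ cong (_×ᴳ u) (≡.sym (≡.trans (ℕP.+-suc (toℕ i) o) 1+i+o≡j)) ⟩
        (toℕ i ℕ.+ suc o) ×ᴳ u      ≈⟨ ×-homo-+ u (toℕ i) (suc o) ⟩
        toℕ i ×ᴳ u ∙ suc o ×ᴳ u     ∎)))

module MarkovChain {S : Setoid 0ℓ 0ℓ} (K : Setoid.Carrier S → Setoid.Carrier S → ℚ)
  (K-cong : ∀ {x x′ y y′} → Setoid._≈_ S x x′ → Setoid._≈_ S y y′ → K x y ≡ K x′ y′) where
  open Setoid S renaming (Carrier to A)

  -- Reach K 0 x y forces x ≡ y, so paths are taken up to ≈ at their end.
  Reach≈ : ℕ → A → A → Set
  Reach≈ n x y = ∃ λ y′ → y′ ≈ y × Reach K n x y′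

  Reach≈-refl : ∀ {x y} → x ≈ y → Reach≈ 0 x y
  Reach≈-refl {x} x≈y = x , x≈y , here

  Reach≈-step : ∀ {x y} → 0ℚ < K x y → Reach≈ 1 x y
  Reach≈-step {y = y} Kxy>0 = y , refl , step Kxy>0 here

  Reach≈-respʳ : ∀ {n x y z} → Reach≈ n x y → y ≈ z → Reach≈ n x z
  Reach≈-respʳ (y′ , y′≈y , r) y≈z = y′ , trans y′≈y y≈z , r

  Reach-respˡ : ∀ {n x y z} → x ≈ y → Reach K n y z → Reach≈ n x z
  Reach-respˡ {x = x} x≈y here           = x , x≈y , here
  Reach-respˡ {z = z} x≈y (step Kyw>0 r) = z , refl , step (subst (0ℚ <_) (K-cong (sym x≈y) refl) Kyw>0) r

  Reach-++ : ∀ {m n x y z} → Reach K m x y → Reach K n y z → Reach K (m ℕ.+ n) x z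
  Reach-++ here           r′ = r′
  Reach-++ (step Kxw>0 r) r′ = step Kxw>0 (Reach-++ r r′)

  Reach≈-trans : ∀ {m n x y z} → Reach≈ m x y → Reach≈ n y z → Reach≈ (m ℕ.+ n) x z
  Reach≈-trans (y′ , y′≈y , r) (z′ , z′≈z , r′) =
    let z″ , z″≈z′ , r″ = Reach-respˡ y′≈y r′
    in z″ , trans z″≈z′ z′≈z , Reach-++ r r″

  Reach≈⇒Reach : ∀ {n x y} → Reach≈ (suc n) x y → Reach K (suc n) x y
  Reach≈⇒Reach (y′ , y′≈y , step Kxy′>0 here)      = step (subst (0ℚ <_) (K-cong refl y′≈y) Kxy′>0) here
  Reach≈⇒Reach (y′ , y′≈y , step Kxw>0 r@(step _ _)) = step Kxw>0 (Reach≈⇒Reach (y′ , y′≈y , r))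

  Serial : Set
  Serial = ∀ x → ∃ λ y → 0ℚ < K x y

  Connected : Set
  Connected = ∀ x y → ∃ λ n → Reach≈ n x y

  Synchronising : ℕ → A → Set
  Synchronising n w = ∀ x → Reach≈ n x w

  irreducible : Serial → Connected → Irreducible K
  irreducible serial connected x y =
    let y₁ , Kxy₁>0 = serial x
        n , y₁⇝y = connected y₁ y
    in suc n , Reach≈⇒Reach (Reach≈-trans (Reach≈-step Kxy₁>0) y₁⇝y)

  aperiodic : ∀ {n w} → Serial → Connected → Synchronising n w → Aperiodic K
  aperiodic {n} {w} serial connected w-sync x d d∣returns =
    let y₁ , Kxy₁>0  = serial x
        y₂ , Ky₁y₂>0 = serial y₁
        m , w⇝x      = connected w x
        d∣1+n+m = d∣returns (suc (n ℕ.+ m)) (s≤s z≤n) (Reach≈⇒Reach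
          (Reach≈-trans (Reach≈-step Kxy₁>0) (Reach≈-trans (w-sync y₁) w⇝x)))
        d∣2+n+m = d∣returns (suc (suc (n ℕ.+ m))) (s≤s z≤n) (Reach≈⇒Reach
          (Reach≈-trans (Reach≈-step Kxy₁>0)
            (Reach≈-trans (Reach≈-step Ky₁y₂>0) (Reach≈-trans (w-sync y₂) w⇝x))))
    in ∣1⇒≡1 (∣m+n∣m⇒∣n (subst (d ∣_) (ℕP.+-comm 1 (suc (n ℕ.+ m))) d∣2+n+m) d∣1+n+m)

module Translations (G : Group 0ℓ 0ℓ) (finG : Finite (Group.setoid G))
  (K : Group.Carrier G → Group.Carrier G → ℚ)
  (K-cong : ∀ {x x′ y y′} → Group._≈_ G x x′ → Group._≈_ G y y′ → K x y ≡ K x′ y′) where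
  open Group G
  open MarkovChain {S = setoid} K K-cong
  open import Algebra.Properties.Monoid.Mult monoid using () renaming (_×_ to _×ᴳ_)

  Translation : Carrier → Set
  Translation u = ∀ x → ∃ λ n → Reach≈ n x (x ∙ u)

  translation-ε : Translation ε
  translation-ε x = 0 , Reach≈-refl (sym (identityʳ x))

  translation-∙ : ∀ {u v} → Translation u → Translation v → Translation (u ∙ v)
  translation-∙ {u} {v} tu tv x =
    let m , x⇝xu = tu x
        n , xu⇝xuv = tv (x ∙ u)
    in m ℕ.+ n , Reach≈-respʳ (Reach≈-trans x⇝xu xu⇝xuv) (assoc x u v)

  translation-resp : ∀ {u v} → u ≈ v → Translation u → Translation v
  translation-resp u≈v tu x = let n , x⇝xu = tu x in n , Reach≈-respʳ x⇝xu (∙-congˡ u≈v)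

  translation-× : ∀ {u} k → Translation u → Translation (k ×ᴳ u)
  translation-× zero    tu = translation-ε
  translation-× (suc k) tu = translation-∙ tu (translation-× k tu)

  translation-⁻¹ : ∀ {u} → Translation u → Translation (u ⁻¹)
  translation-⁻¹ {u} tu =
    let k , ku≈u⁻¹ = inverse-is-multiple G finG u
    in translation-resp ku≈u⁻¹ (translation-× k tu)

  all-translations⇒connected : (∀ u → Translation u) → Connected
  all-translations⇒connected all-translations x y =
    let n , x⇝x[x⁻¹y] = all-translations (x ⁻¹ ∙ y) x
    in n , Reach≈-respʳ x⇝x[x⁻¹y] x[x⁻¹y]≈y
    where
    x[x⁻¹y]≈y : x ∙ (x ⁻¹ ∙ y) ≈ y
    x[x⁻¹y]≈y = trans (sym (assoc x (x ⁻¹) y)) (trans (∙-congʳ (inverseʳ x)) (identityˡ y))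

module WalkProperties (R : CommutativeRing 0ℓ 0ℓ) (V : Module R 0ℓ 0ℓ)
  (finR : Finite (CommutativeRing.setoid R)) (finV : Finite (Module.≈ᴹ-setoid V)) where
  open Walks R V finR finV
  open CommutativeRing R using (0#; 1#) renaming (Carrier to Scalar; _*_ to _·_)
  open Module V

  module KernelOnV (K : Carrierᴹ → Carrierᴹ → ℚ)
    (K-cong : ∀ {x x′ y y′} → x ≈ᴹ x′ → y ≈ᴹ y′ → K x y ≡ K x′ y′) where
    open MarkovChain {S = ≈ᴹ-setoid} K K-cong public
    open Translations +ᴹ-group finV K K-cong

    TranslationSteps : (Carrierᴹ → Set) → Set
    TranslationSteps S = ∀ {b} → S b → ∀ x → 0ℚ < K x (x +ᴹ b)

    AffineSteps : (Scalar → Set) → Set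
    AffineSteps T = ∀ {a} → T a → ∃ λ w → ∀ x → 0ℚ < K x (a *ₗ x +ᴹ w)

    AffineReach : Scalar → Set
    AffineReach c = ∃ λ n → ∃ λ w → ∀ x → Reach≈ n x (c *ₗ x +ᴹ w)

    addGen⇒translation : ∀ {S u} → TranslationSteps S → AddGen S u → Translation u
    addGen⇒translation steps (gen b∈S) x = 1 , Reach≈-step (steps b∈S x)
    addGen⇒translation steps zer        = translation-ε
    addGen⇒translation steps (add g h)  =
      translation-∙ (addGen⇒translation steps g) (addGen⇒translation steps h)
    addGen⇒translation steps (neg g)    = translation-⁻¹ (addGen⇒translation steps g)
    addGen⇒translation steps (resp u≈v g) = translation-resp u≈v (addGen⇒translation steps g)

    mulGen⇒affineReach : ∀ {T c} → AffineSteps T → MulGen T c → AffineReach c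
    mulGen⇒affineReach steps (gen a∈T) =
      let w , step-a = steps a∈T in 1 , w , λ x → Reach≈-step (step-a x)
    mulGen⇒affineReach steps one =
      0 , 0ᴹ , λ x → Reach≈-refl (≈ᴹ-sym (≈ᴹ-trans (+ᴹ-identityʳ _) (*ₗ-identityˡ x)))
    mulGen⇒affineReach steps (mul {a} {b} ga gb) =
      let n₁ , w₁ , reach-a = mulGen⇒affineReach steps ga
          n₂ , w₂ , reach-b = mulGen⇒affineReach steps gb
      in n₂ ℕ.+ n₁ , a *ₗ w₂ +ᴹ w₁ ,
         λ x → Reach≈-respʳ (Reach≈-trans (reach-b x) (reach-a (b *ₗ x +ᴹ w₂))) (compose x)
      where
      compose : ∀ {w₁ w₂} x → a *ₗ (b *ₗ x +ᴹ w₂) +ᴹ w₁ ≈ᴹ (a · b) *ₗ x +ᴹ (a *ₗ w₂ +ᴹ w₁)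
      compose x = ≈ᴹ-trans (+ᴹ-congʳ (*ₗ-distribˡ a (b *ₗ x) _))
                    (≈ᴹ-trans (+ᴹ-assoc _ _ _) (+ᴹ-congʳ (≈ᴹ-sym (*ₗ-assoc a b x))))
    mulGen⇒affineReach steps (resp a≈b g) =
      let n , w , reach = mulGen⇒affineReach steps g
      in n , w , λ x → Reach≈-respʳ (reach x) (+ᴹ-congʳ (*ₗ-cong a≈b ≈ᴹ-refl))

    generated⇒connected : ∀ {S} → TranslationSteps S → GeneratesV S → Connected
    generated⇒connected steps generates = all-translations⇒connected λ u → addGen⇒translation steps (generates u)

    zero∈mulGen⇒synchronising : ∀ {T} → AffineSteps T → MulGen T 0# → ∃ λ n → ∃ λ w → Synchronising n w
    zero∈mulGen⇒synchronising steps 0∈T* =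
      let n , w , reach = mulGen⇒affineReach steps 0∈T*
      in n , w , λ x → Reach≈-respʳ (reach x) (≈ᴹ-trans (+ᴹ-congʳ (*ₗ-zeroˡ x)) (+ᴹ-identityˡ w))

    irreducible-if-generated : ∀ {S} → Serial → TranslationSteps S → GeneratesV S → Irreducible K
    irreducible-if-generated serial steps generates =
      irreducible serial (generated⇒connected steps generates)

    aperiodic-if-generated : ∀ {S T} → Serial → TranslationSteps S → GeneratesV S →
                             AffineSteps T → MulGen T 0# → Aperiodic K
    aperiodic-if-generated serial steps generates affine-steps 0∈T* =
      let _ , _ , w-sync = zero∈mulGen⇒synchronising affine-steps 0∈T*
      in aperiodic serial (generated⇒connected steps generates) w-sync

  module CoinToss (P : Dist finV) (Q : Dist finR) (α : ℚ) (α>0 : 0ℚ < α) (α<1 : α < 1ℚ) where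
    1-α>0 : 0ℚ < 1ℚ - α
    1-α>0 = subst (_< 1ℚ - α) (ℚP.+-inverseʳ α) (ℚP.+-monoˡ-< (ℚ.- α) α<1)

    coinToss-cong : ∀ {x x′ y y′} → x ≈ᴹ x′ → y ≈ᴹ y′ → coinToss α P Q x y ≡ coinToss α P Q x′ y′
    coinToss-cong {x} {x′} x≈x′ y≈y′ = cong₂ _+_
      (cong (α *_) (pushforward-cong finV finV P {f = x +ᴹ_} {g = x′ +ᴹ_}
        (λ _ → +ᴹ-congʳ x≈x′) y≈y′))
      (cong ((1ℚ - α) *_) (pushforward-cong finR finV Q {f = _*ₗ x} {g = _*ₗ x′}
        (λ _ → *ₗ-cong (CommutativeRing.refl R) x≈x′) y≈y′))

    open KernelOnV (coinToss α P Q) coinToss-cong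

    heads-steps : TranslationSteps (SuppV P)
    heads-steps {b} Pb>0 x = ℚP.+-mono-<-≤
      (*-pos α>0 (pushforward-pos finV finV P {f = x +ᴹ_} +ᴹ-congˡ Pb>0 ≈ᴹ-refl))
      (*-nonNeg (ℚP.<⇒≤ 1-α>0) (pushforward-nonNeg finR finV Q (_*ₗ x) _))

    tails-steps : AffineSteps (SuppR Q)
    tails-steps {a} Qa>0 = 0ᴹ , λ x → ℚP.+-mono-≤-<
      (*-nonNeg (ℚP.<⇒≤ α>0) (pushforward-nonNeg finV finV P (x +ᴹ_) _))
      (*-pos 1-α>0 (pushforward-pos finR finV Q {f = _*ₗ x} (λ a≈a′ → *ₗ-cong a≈a′ ≈ᴹ-refl) Qa>0
        (≈ᴹ-sym (+ᴹ-identityʳ _))))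

    serial : Serial
    serial x = let b , Pb>0 = support-nonempty finV P in x +ᴹ b , heads-steps Pb>0 x

    coinToss-irreducible : GeneratesV (SuppV P) → Irreducible (coinToss α P Q)
    coinToss-irreducible = irreducible-if-generated serial heads-steps

    coinToss-aperiodic : GeneratesV (SuppV P) → MulGen (SuppR Q) 0# → Aperiodic (coinToss α P Q)
    coinToss-aperiodic generates = aperiodic-if-generated serial heads-steps generates tails-steps

  module Affine (P : Dist finV) (Q : Dist finR) (1∈suppQ : SuppR Q 1#) where
    affine-term-nonNeg : ∀ x y j i →
      0ℚ ≤ Dist.prob Q j * Dist.prob P i * [ elem finR j *ₗ x +ᴹ elem finV i ≟ y ]in finV
    affine-term-nonNeg x y j i =
      *-nonNeg (*-nonNeg (Dist.nonneg Q j) (Dist.nonneg P i)) (indicator-nonNeg finV _ _)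

    affine-cong : ∀ {x x′ y y′} → x ≈ᴹ x′ → y ≈ᴹ y′ → affine P Q x y ≡ affine P Q x′ y′
    affine-cong x≈x′ y≈y′ = sumFin-cong λ j → sumFin-cong λ i →
      cong (Dist.prob Q j * Dist.prob P i *_)
        (indicator-cong finV (+ᴹ-congʳ (*ₗ-cong (CommutativeRing.refl R) x≈x′)) y≈y′)

    affine-pos : ∀ {a b} → SuppR Q a → SuppV P b → ∀ x → 0ℚ < affine P Q x (a *ₗ x +ᴹ b)
    affine-pos {a} {b} Qa>0 Pb>0 x =
      sumFin-pos _ (λ j → sumFin-nonNeg _ (affine-term-nonNeg x y j)) (index finR a)
        (sumFin-pos _ (affine-term-nonNeg x y (index finR a)) (index finV b)
          (subst (0ℚ <_) (≡.sym (≡.trans (cong (Pr Q a * Pr P b *_) indicator≡1) (ℚP.*-identityʳ _)))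
            (*-pos Qa>0 Pb>0)))
      where
      y = a *ₗ x +ᴹ b
      indicator≡1 : [ elem finR (index finR a) *ₗ x +ᴹ elem finV (index finV b) ≟ y ]in finV ≡ 1ℚ
      indicator≡1 = indicator-≈ finV (+ᴹ-cong (*ₗ-cong (elem-index finR a) ≈ᴹ-refl) (elem-index finV b))

    open KernelOnV (affine P Q) affine-cong

    translation-steps : TranslationSteps (SuppV P)
    translation-steps Pb>0 x =
      subst (0ℚ <_) (affine-cong ≈ᴹ-refl (+ᴹ-congʳ (*ₗ-identityˡ x))) (affine-pos 1∈suppQ Pb>0 x)

    affine-steps : AffineSteps (SuppR Q)
    affine-steps Qa>0 = let b , Pb>0 = support-nonempty finV P in b , affine-pos Qa>0 Pb>0

    serial : Serial
    serial x = let b , Pb>0 = support-nonempty finV P in x +ᴹ b , translation-steps Pb>0 x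

    affine-irreducible : GeneratesV (SuppV P) → Irreducible (affine P Q)
    affine-irreducible = irreducible-if-generated serial translation-steps

    affine-aperiodic : GeneratesV (SuppV P) → MulGen (SuppR Q) 0# → Aperiodic (affine P Q)
    affine-aperiodic generates = aperiodic-if-generated serial translation-steps generates affine-steps

proposition1p2 : (R : CommutativeRing 0ℓ 0ℓ) (V : Module R 0ℓ 0ℓ)
    (finR : Finite (CommutativeRing.setoid R))
    (finV : Finite (Module.≈ᴹ-setoid V))
    (P : Dist finV) (Q : Dist finR) →
    let open Walks R V finR finV in
    (∀ α → 0ℚ < α → α < 1ℚ →
      (GeneratesV (SuppV P) → Irreducible (coinToss α P Q))
      × (GeneratesV (SuppV P) → MulGen (SuppR Q) (CommutativeRing.0# R)
           → Aperiodic (coinToss α P Q)))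
    × ((GeneratesV (SuppV P) → SuppR Q (CommutativeRing.1# R) → Irreducible (affine P Q))
      × (GeneratesV (SuppV P) → SuppR Q (CommutativeRing.1# R)
           → MulGen (SuppR Q) (CommutativeRing.0# R) → Aperiodic (affine P Q)))
proposition1p2 R V finR finV P Q =
    (λ α α>0 α<1 → let open CoinToss P Q α α>0 α<1 in coinToss-irreducible , coinToss-aperiodic)
  , (λ generates 1∈suppQ → Affine.affine-irreducible P Q 1∈suppQ generates)
  , (λ generates 1∈suppQ → Affine.affine-aperiodic P Q 1∈suppQ generates)
  where open WalkProperties R V finR finV
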